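{- Let $n\ge 2$ and let $\pi=[\pi_1,\dots,\pi_{n-1}]\in B_{n-1}$. For $i\in\{0,1,\dots,n-1\}$ let $\pi_{n,i}\in B_n$ (resp. $\pi_{ -n,i}\in B_n$) be the signed permutation with one-line notation $[\pi_1,\dots,\pi_i,n,\pi_{i+1},\dots,\pi_{n-1}]$ (resp. $[\pi_1,\dots,\pi_i,-n,\pi_{i+1},\dots,\pi_{n-1}]$), i.e. obtained by inserting $n$ (resp. $-n$) immediately after $\pi_i$ (immediately before $\pi_1$ if $i=0$). Then \begin{enumerate} \item $inv(\pi_{n,i})=n-i-1+inv(\pi)$; \item $inv(\pi_{ -n,i})=n+i+inv(\pi)$. \end{enumerate}
   Context: For $m\ge1$, let $e_1,\dots,e_m$ be the standard basis of $\mathbb{R}^m$. The hyperoctahedral group $B_m$ is the group of signed permutations: linear maps $w$ of $\mathbb{R}^m$ with $w(e_k)=\varepsilon_k e_{\beta(k)}$, $\beta\in S_m$, $\varepsilon_k\in\{\pm1\}$; one-line notation $w=[w(1),\dots,w(m)]$ with $w(k)=\varepsilon_k\beta(k)$. Positive roots of $B_m$: $\Psi^+=\{e_l:1\le l\le m\}\cup\{e_j-e_i,\ e_j+e_i:1\le i<j\le m\}$, $\Psi^-=-\Psi^+$. For $i=1,\dots,m$ put $\Psi_i=\{e_{m+1-i}\}\cup\{e_{m+1-i}-e_j,\ e_{m+1-i}+e_j:1\le j<m+1-i\}$, $inv_i(w)=|w(\Psi_i)\cap\Psi^-|$ and $inv(w)=\sum_{i=1}^m inv_i(w)$ (computed in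 the group $B_m$ to which $w$ belongs). -}

module Defs where

open import Data.Nat as ℕ using (ℕ; zero; suc)
open import Data.Integer as ℤ using (ℤ; +_; -_; ∣_∣; sign; _◃_)
import Data.Integer.Properties as ℤP
open import Data.Fin as Fin using (Fin; toℕ; opposite; _<?_)
open import Data.Fin.Permutation using (Permutation′; _⟨$⟩ʳ_)
open import Data.Sign using (Sign)
open import Data.Vec as Vec using (Vec; lookup; tabulate; zipWith)
import Data.Vec.Properties as VecP
open import Data.Nat.ListAction using (sum)
open import Data.List as List using (List; []; _∷_; _++_; concatMap; filter; length; allFin)
open import Data.Product using (Σ; _×_; _,_)
open import Relation.Binary.PropositionalEquality using (_≡_)
open import Relation.Nullary.Decidable using (does)
open import Data.Bool using (if_then_else_)
import Data.List.Membership.DecPropositional as DecMem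

-- A signed permutation w ∈ B_m is represented by its one-line notation
-- [w(1),…,w(m)] as a vector of integers.  The predicate below says the
-- vector is the one-line notation of some w with w(e_k) = ε_k e_{β(k)}:
-- entry k (0-based) equals ε_k · (β(k)+1), for β ∈ S_m and signs ε_k.
IsSignedPerm : {m : ℕ} → Vec ℤ m → Set
IsSignedPerm {m} v =
  Σ (Permutation′ m) λ β → Σ (Fin m → Sign) λ ε →
    ∀ k → lookup v k ≡ ε k ◃ suc (toℕ (β ⟨$⟩ʳ k))

-- Vectors of ℤ^m (the roots are integral, so ℤ^m suffices).
Vect : ℕ → Set
Vect m = Vec ℤ m

e : {m : ℕ} → Fin m → Vect m
e k = tabulate λ j → if does (j Fin.≟ k) then + 1 else + 0

_⊕_ _⊖_ : {m : ℕ} → Vect m → Vect m → Vect m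
x ⊕ y = zipWith ℤ._+_ x y
x ⊖ y = zipWith ℤ._-_ x y

neg : {m : ℕ} → Vect m → Vect m
neg = Vec.map -_

sumℤ : {m : ℕ} → Vec ℤ m → ℤ
sumℤ = Vec.foldr _ ℤ._+_ (+ 0)

-- Linear action of the signed permutation with one-line notation v on ℤ^m:
-- w(e_k) = sign(v_k) e_{|v_k|}, i.e. (w x)_j = Σ_k [|v_k| = j+1] sign(v_k) x_k.
act : {m : ℕ} → Vec ℤ m → Vect m → Vect m
act {m} v x = tabulate λ j → sumℤ (tabulate λ k →
  if does (∣ lookup v k ∣ ℕ.≟ suc (toℕ j))
  then (sign (lookup v k) ◃ 1) ℤ.* lookup x k
  else + 0)

Ψ⁺ : (m : ℕ) → List (Vect m)
Ψ⁺ m = List.map e (allFin m)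
    ++ concatMap (λ j → concatMap (λ i → (e j ⊖ e i) ∷ (e j ⊕ e i) ∷ [])
                                  (filter (_<? j) (allFin m)))
                 (allFin m)

Ψ⁻ : (m : ℕ) → List (Vect m)
Ψ⁻ m = List.map neg (Ψ⁺ m)

-- Ψ_i for paper index i ∈ {1,…,m}, encoded by i' : Fin m with i = toℕ i' + 1.
-- Then m+1-i (1-based) is the 0-based index  p = m-1-toℕ i' = opposite i'.
-- Ψ_i = {e_p} ∪ {e_p - e_j, e_p + e_j : j < p}
Ψ : {m : ℕ} → Fin m → List (Vect m)
Ψ {m} i = e p ∷ concatMap (λ j → (e p ⊖ e j) ∷ (e p ⊕ e j) ∷ [])
                          (filter (_<? p) (allFin m))
  where p = opposite i

module _ {m : ℕ} where
  open DecMem (VecP.≡-dec {n = m} ℤ._≟_) using (_∈?_)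

  -- inv_i(w) = |w(Ψ_i) ∩ Ψ⁻|  (w is injective, so count r ∈ Ψ_i with w r ∈ Ψ⁻)
  invᵢ : Vec ℤ m → Fin m → ℕ
  invᵢ w i = length (filter (λ r → act w r ∈? Ψ⁻ m) (Ψ i))

inv : {m : ℕ} → Vec ℤ m → ℕ
inv {m} w = sum (List.map (invᵢ w) (allFin m))

{-# OPTIONS --safe #-}
-- Write w(e_k) = sign(w_k) e_{|w_k|}.  With p = m + 1 − i, the roots of Ψ_i are e_p and e_p ± e_j
-- with j < p, and w maps each of them to a vector with at most two nonzero coordinates, both ±1; such a
-- vector is a negative root exactly when its nonzero coordinate of largest index is −1.  Hence
-- w e_p ∈ Ψ⁻ iff w_p < 0, and w (e_p ± e_j) ∈ Ψ⁻ iff the one of w_p, ±w_j of larger absolute value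
-- is negative.  So inv w = Σ_p ([w_p < 0] + Σ_{j<p} h(w_p, w_j)), where h depends only on the two
-- entries.  An entry z = ±n inserted after the first i entries dominates all others in absolute
-- value: h(y, z) = 1 for each of the n − 1 − i entries y after it and h(z, x) = 2[z < 0] for each of
-- the i entries x before it, while z itself contributes [z < 0].
module Submission where

open import Defs
open import Data.Nat using (ℕ; suc; _+_; _∸_; _≤_)
open import Data.Integer using (ℤ; +_; -[1+_])
open import Data.Fin using (Fin; toℕ)
open import Data.Vec using (Vec; insertAt)
open import Data.Product using (_×_)
open import Relation.Binary.PropositionalEquality using (_≡_)

open import Data.Bool using (Bool; true; false; if_then_else_)
open import Data.Bool.Properties using (if-float)
open import Data.Empty using (⊥-elim)
open import Data.Fin as F using (opposite)
import Data.Fin.Properties as FP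
open import Data.Fin.Permutation using (reverse; _⟨$⟩ʳ_; _⟨$⟩ˡ_; inverseˡ)
open import Data.Integer as Z using (∣_∣; sign; _◃_; 0ℤ)
import Data.Integer.Properties as ZP
open import Data.List as L using (List; []; _∷_)
import Data.List.Properties as LP
open import Data.List.Membership.Propositional using (_∈_; find; lose)
open import Data.List.Membership.Propositional.Properties
  using (∈-++⁻; ∈-++⁺ˡ; ∈-++⁺ʳ; ∈-map⁻; ∈-map⁺; ∈-concatMap⁻; ∈-concatMap⁺; ∈-filter⁻; ∈-filter⁺; ∈-allFin)
import Data.List.Membership.DecPropositional as DecMem
open import Data.List.Relation.Unary.Any using (here; there)
open import Data.Nat as N using (zero; _*_)
open import Data.Nat.ListAction using () renaming (sum to sumᴸ)
import Data.Nat.ListAction.Properties as NLP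
import Data.Nat.Properties as NP
open import Data.Nat.Tactic.RingSolver using (solve-∀)
open import Data.Product using (∃; _,_; proj₂)
open import Data.Sign as Sign using ()
open import Data.Sum using (_⊎_; inj₁; inj₂)
open import Data.Vec as V using (lookup; tabulate)
import Data.Vec.Properties as VP
open import Function using (_∘_; id; _⇔_; mk⇔)
open import Function.Construct.Composition using (_⇔-∘_)
open import Relation.Binary.Definitions using (tri<; tri≈; tri>)
open import Relation.Binary.PropositionalEquality
  using (refl; sym; trans; cong; cong₂; subst; subst₂; _≢_; module ≡-Reasoning)
open import Relation.Nullary using (Dec; yes; no; does; ¬_; contradiction)
open import Relation.Nullary.Decidable using (dec-true; dec-false; does-⇔)
open import Algebra.Properties.CommutativeMonoid.Sum NP.+-0-commutativeMonoid
  using (sum-cong-≗; sum-replicate-zero; ∑-distrib-+; sum-permute) renaming (sum to ∑)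
open import Algebra.Properties.CommutativeSemigroup NP.+-commutativeSemigroup using (x∙yz≈y∙xz)
open import Algebra.Properties.CommutativeSemigroup ZP.+-commutativeSemigroup using (interchange)
open ≡-Reasoning

[_] : Bool → ℕ
[ true ] = 1
[ false ] = 0

∑-const-1 : ∀ n → ∑ {n} (λ _ → 1) ≡ n
∑-const-1 zero = refl
∑-const-1 (suc n) = cong suc (∑-const-1 n)

∑-reverse : ∀ {n} (f : Fin n → ℕ) → ∑ (f ∘ opposite) ≡ ∑ f
∑-reverse f = sym (sum-permute f reverse)

sumᴸ-tabulate : ∀ {n} (f : Fin n → ℕ) → sumᴸ (L.tabulate f) ≡ ∑ f
sumᴸ-tabulate {zero} f = refl
sumᴸ-tabulate {suc n} f = cong (_+_ (f F.zero)) (sumᴸ-tabulate (f ∘ F.suc))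

sumᴸ-map-allFin : ∀ {n} (f : Fin n → ℕ) → sumᴸ (L.map f (L.allFin n)) ≡ ∑ f
sumᴸ-map-allFin f = trans (cong sumᴸ (LP.map-tabulate id f)) (sumᴸ-tabulate f)

module _ {a p} {A : Set a} {P : A → Set p} (P? : ∀ x → Dec (P x)) where

  length-filter : ∀ xs → L.length (L.filter P? xs) ≡ sumᴸ (L.map (λ x → [ does (P? x) ]) xs)
  length-filter [] = refl
  length-filter (x ∷ xs) with does (P? x)
  ... | true = cong suc (length-filter xs)
  ... | false = length-filter xs

  sumᴸ-map-filter : ∀ (f : A → ℕ) xs →
    sumᴸ (L.map f (L.filter P? xs)) ≡ sumᴸ (L.map (λ x → if does (P? x) then f x else 0) xs)
  sumᴸ-map-filter f [] = refl
  sumᴸ-map-filter f (x ∷ xs) with does (P? x)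
  ... | true = cong (_+_ (f x)) (sumᴸ-map-filter f xs)
  ... | false = sumᴸ-map-filter f xs

sumᴸ-map-concatMap : ∀ {a b} {A : Set a} {B : Set b} (f : B → ℕ) (g : A → List B) xs →
  sumᴸ (L.map f (L.concatMap g xs)) ≡ sumᴸ (L.map (sumᴸ ∘ L.map f ∘ g) xs)
sumᴸ-map-concatMap f g [] = refl
sumᴸ-map-concatMap f g (x ∷ xs) = begin
  sumᴸ (L.map f (g x L.++ L.concatMap g xs))               ≡⟨ cong sumᴸ (LP.map-++ f (g x) _) ⟩
  sumᴸ (L.map f (g x) L.++ L.map f (L.concatMap g xs))     ≡⟨ NLP.sum-++ (L.map f (g x)) _ ⟩
  sumᴸ (L.map f (g x)) + sumᴸ (L.map f (L.concatMap g xs)) ≡⟨ cong (_+_ (sumᴸ (L.map f (g x)))) (sumᴸ-map-concatMap f g xs) ⟩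
  sumᴸ (L.map f (g x)) + sumᴸ (L.map (sumᴸ ∘ L.map f ∘ g) xs) ∎

vec-ext : ∀ {m} {x y : Vect m} → (∀ j → lookup x j ≡ lookup y j) → x ≡ y
vec-ext {x = x} {y} eq = trans (sym (VP.tabulate∘lookup x)) (trans (VP.tabulate-cong eq) (VP.tabulate∘lookup y))

lookup-⊕ : ∀ {m} (x y : Vect m) j → lookup (x ⊕ y) j ≡ lookup x j Z.+ lookup y j
lookup-⊕ x y j = VP.lookup-zipWith Z._+_ j x y

lookup-neg : ∀ {m} (x : Vect m) j → lookup (neg x) j ≡ Z.- lookup x j
lookup-neg x j = VP.lookup-map j Z.-_ x

⊖≡⊕neg : ∀ {m} (x y : Vect m) → x ⊖ y ≡ x ⊕ neg y
⊖≡⊕neg x y = vec-ext λ j → begin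
  lookup (x ⊖ y) j               ≡⟨ VP.lookup-zipWith Z._-_ j x y ⟩
  lookup x j Z.+ Z.- lookup y j  ≡⟨ cong (Z._+_ (lookup x j)) (lookup-neg y j) ⟨
  lookup x j Z.+ lookup (neg y) j ≡⟨ lookup-⊕ x (neg y) j ⟨
  lookup (x ⊕ neg y) j           ∎

⊕-comm : ∀ {m} (x y : Vect m) → x ⊕ y ≡ y ⊕ x
⊕-comm x y = vec-ext λ j →
  trans (lookup-⊕ x y j) (trans (ZP.+-comm (lookup x j) _) (sym (lookup-⊕ y x j)))

neg-⊕ : ∀ {m} (x y : Vect m) → neg (x ⊕ y) ≡ neg x ⊕ neg y
neg-⊕ x y = vec-ext λ j → begin
  lookup (neg (x ⊕ y)) j                 ≡⟨ trans (lookup-neg (x ⊕ y) j) (cong Z.-_ (lookup-⊕ x y j)) ⟩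
  Z.- (lookup x j Z.+ lookup y j)        ≡⟨ ZP.neg-distrib-+ (lookup x j) (lookup y j) ⟩
  Z.- lookup x j Z.+ Z.- lookup y j      ≡⟨ cong₂ Z._+_ (lookup-neg x j) (lookup-neg y j) ⟨
  lookup (neg x) j Z.+ lookup (neg y) j  ≡⟨ lookup-⊕ (neg x) (neg y) j ⟨
  lookup (neg x ⊕ neg y) j               ∎

neg-involutive : ∀ {m} (x : Vect m) → neg (neg x) ≡ x
neg-involutive x = vec-ext λ j →
  trans (lookup-neg (neg x) j) (trans (cong Z.-_ (lookup-neg x j)) (ZP.neg-involutive (lookup x j)))

-- e a is definitionally (+ 1) ·e a.
infix 25 _·e_

_·e_ : ∀ {m} → ℤ → Fin m → Vect m
s ·e a = tabulate λ j → if does (j F.≟ a) then s else 0ℤ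

lookup-·e-same : ∀ {m} s (a : Fin m) → lookup (s ·e a) a ≡ s
lookup-·e-same s a rewrite VP.lookup∘tabulate (λ j → if does (j F.≟ a) then s else 0ℤ) a
                         | dec-true (a F.≟ a) refl = refl

lookup-·e-other : ∀ {m} s {a j : Fin m} → a ≢ j → lookup (s ·e a) j ≡ 0ℤ
lookup-·e-other s {a} {j} a≢j rewrite VP.lookup∘tabulate (λ j → if does (j F.≟ a) then s else 0ℤ) j
                                    | dec-false (j F.≟ a) (a≢j ∘ sym) = refl

neg-·e : ∀ {m} s (a : Fin m) → neg (s ·e a) ≡ (Z.- s) ·e a
neg-·e s a = vec-ext λ j →
  trans (lookup-neg (s ·e a) j) (trans (cong Z.-_ (VP.lookup∘tabulate _ j))
    (trans (if-float Z.-_ (does (j F.≟ a))) (sym (VP.lookup∘tabulate _ j))))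

sumℤ-tabulate-+ : ∀ {m} (f g : Fin m → ℤ) →
  sumℤ (tabulate λ k → f k Z.+ g k) ≡ sumℤ (tabulate f) Z.+ sumℤ (tabulate g)
sumℤ-tabulate-+ {zero} f g = refl
sumℤ-tabulate-+ {suc m} f g =
  trans (cong (Z._+_ (f F.zero Z.+ g F.zero)) (sumℤ-tabulate-+ (f ∘ F.suc) (g ∘ F.suc)))
        (interchange (f F.zero) (g F.zero) _ _)

sumℤ-tabulate-neg : ∀ {m} (f : Fin m → ℤ) → sumℤ (tabulate λ k → Z.- f k) ≡ Z.- sumℤ (tabulate f)
sumℤ-tabulate-neg {zero} f = refl
sumℤ-tabulate-neg {suc m} f =
  trans (cong (Z._+_ (Z.- f F.zero)) (sumℤ-tabulate-neg (f ∘ F.suc)))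
        (sym (ZP.neg-distrib-+ (f F.zero) _))

sumℤ-tabulate-zero : ∀ {m} (f : Fin m → ℤ) → (∀ k → f k ≡ 0ℤ) → sumℤ (tabulate f) ≡ 0ℤ
sumℤ-tabulate-zero {zero} f f≡0 = refl
sumℤ-tabulate-zero {suc m} f f≡0 = cong₂ Z._+_ (f≡0 F.zero) (sumℤ-tabulate-zero (f ∘ F.suc) (f≡0 ∘ F.suc))

sumℤ-tabulate-single : ∀ {m} (f : Fin m → ℤ) p → (∀ k → k ≢ p → f k ≡ 0ℤ) → sumℤ (tabulate f) ≡ f p
sumℤ-tabulate-single f F.zero f≡0 =
  trans (cong (Z._+_ (f F.zero)) (sumℤ-tabulate-zero (f ∘ F.suc) λ k → f≡0 (F.suc k) λ ()))
        (ZP.+-identityʳ (f F.zero))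
sumℤ-tabulate-single f (F.suc p) f≡0 =
  trans (cong₂ Z._+_ (f≡0 F.zero λ ()) (sumℤ-tabulate-single (f ∘ F.suc) p λ k k≢p → f≡0 (F.suc k) (k≢p ∘ FP.suc-injective)))
        (ZP.+-identityˡ (f (F.suc p)))

⟨_,_⟩ : ∀ {m} → (Fin m → ℤ) → Vect m → ℤ
⟨ c , x ⟩ = sumℤ (tabulate λ k → c k Z.* lookup x k)

⟨⟩-⊕ : ∀ {m} (c : Fin m → ℤ) x y → ⟨ c , x ⊕ y ⟩ ≡ ⟨ c , x ⟩ Z.+ ⟨ c , y ⟩
⟨⟩-⊕ c x y = trans
  (cong sumℤ (VP.tabulate-cong λ k → trans (cong (Z._*_ (c k)) (lookup-⊕ x y k)) (ZP.*-distribˡ-+ (c k) (lookup x k) (lookup y k))))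
  (sumℤ-tabulate-+ (λ k → c k Z.* lookup x k) (λ k → c k Z.* lookup y k))

⟨⟩-neg : ∀ {m} (c : Fin m → ℤ) x → ⟨ c , neg x ⟩ ≡ Z.- ⟨ c , x ⟩
⟨⟩-neg c x = trans
  (cong sumℤ (VP.tabulate-cong λ k → trans (cong (Z._*_ (c k)) (lookup-neg x k)) (sym (ZP.neg-distribʳ-* (c k) (lookup x k)))))
  (sumℤ-tabulate-neg (λ k → c k Z.* lookup x k))

⟨⟩-e : ∀ {m} (c : Fin m → ℤ) p → ⟨ c , e p ⟩ ≡ c p
⟨⟩-e c p = begin
  ⟨ c , e p ⟩             ≡⟨ sumℤ-tabulate-single (λ k → c k Z.* lookup (e p) k) p off-p ⟩
  c p Z.* lookup (e p) p  ≡⟨ cong (Z._*_ (c p)) (lookup-·e-same (+ 1) p) ⟩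
  c p Z.* + 1             ≡⟨ ZP.*-identityʳ (c p) ⟩
  c p                     ∎
  where
  off-p : ∀ k → k ≢ p → c k Z.* lookup (e p) k ≡ 0ℤ
  off-p k k≢p = trans (cong (Z._*_ (c k)) (lookup-·e-other (+ 1) (k≢p ∘ sym))) (ZP.*-zeroʳ (c k))

actCoeff : ∀ {m} → Vec ℤ m → Fin m → Fin m → ℤ
actCoeff v j k = if does (∣ lookup v k ∣ N.≟ suc (toℕ j)) then sign (lookup v k) ◃ 1 else 0ℤ

lookup-act : ∀ {m} (v : Vec ℤ m) x j → lookup (act v x) j ≡ ⟨ actCoeff v j , x ⟩
lookup-act v x j = trans (VP.lookup∘tabulate _ j) (cong sumℤ (VP.tabulate-cong λ k →
  sym (if-float (Z._* lookup x k) (does (∣ lookup v k ∣ N.≟ suc (toℕ j))))))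

act-⊕ : ∀ {m} (v : Vec ℤ m) x y → act v (x ⊕ y) ≡ act v x ⊕ act v y
act-⊕ v x y = vec-ext λ j → begin
  lookup (act v (x ⊕ y)) j                             ≡⟨ lookup-act v (x ⊕ y) j ⟩
  ⟨ actCoeff v j , x ⊕ y ⟩                             ≡⟨ ⟨⟩-⊕ (actCoeff v j) x y ⟩
  ⟨ actCoeff v j , x ⟩ Z.+ ⟨ actCoeff v j , y ⟩        ≡⟨ cong₂ Z._+_ (lookup-act v x j) (lookup-act v y j) ⟨
  lookup (act v x) j Z.+ lookup (act v y) j            ≡⟨ lookup-⊕ (act v x) (act v y) j ⟨
  lookup (act v x ⊕ act v y) j                         ∎

act-neg : ∀ {m} (v : Vec ℤ m) x → act v (neg x) ≡ neg (act v x)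
act-neg v x = vec-ext λ j → begin
  lookup (act v (neg x)) j     ≡⟨ lookup-act v (neg x) j ⟩
  ⟨ actCoeff v j , neg x ⟩     ≡⟨ ⟨⟩-neg (actCoeff v j) x ⟩
  Z.- ⟨ actCoeff v j , x ⟩     ≡⟨ cong Z.-_ (lookup-act v x j) ⟨
  Z.- lookup (act v x) j       ≡⟨ lookup-neg (act v x) j ⟨
  lookup (neg (act v x)) j     ∎

act-⊖ : ∀ {m} (v : Vec ℤ m) x y → act v (x ⊖ y) ≡ act v x ⊕ neg (act v y)
act-⊖ v x y = begin
  act v (x ⊖ y)                ≡⟨ cong (act v) (⊖≡⊕neg x y) ⟩
  act v (x ⊕ neg y)            ≡⟨ act-⊕ v x (neg y) ⟩
  act v x ⊕ act v (neg y)      ≡⟨ cong (act v x ⊕_) (act-neg v y) ⟩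
  act v x ⊕ neg (act v y)      ∎

unit : ∀ {m} → ℤ → Vect m
unit x = tabulate λ j → if does (∣ x ∣ N.≟ suc (toℕ j)) then sign x ◃ 1 else 0ℤ

act-e : ∀ {m} (v : Vec ℤ m) p → act v (e p) ≡ unit (lookup v p)
act-e v p = vec-ext λ j → trans (lookup-act v (e p) j) (trans (⟨⟩-e (actCoeff v j) p) (sym (VP.lookup∘tabulate _ j)))

neg-unit : ∀ {m} x → neg (unit {m} x) ≡ unit (Z.- x)
neg-unit x = vec-ext λ j → begin
  lookup (neg (unit x)) j                  ≡⟨ trans (lookup-neg (unit x) j) (cong Z.-_ (VP.lookup∘tabulate _ j)) ⟩
  Z.- (if does (∣ x ∣ N.≟ suc (toℕ j)) then sign x ◃ 1 else 0ℤ)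
                                           ≡⟨ if-float Z.-_ (does (∣ x ∣ N.≟ suc (toℕ j))) ⟩
  (if does (∣ x ∣ N.≟ suc (toℕ j)) then Z.- (sign x ◃ 1) else 0ℤ)
                                           ≡⟨ negate-coefficient x j ⟩
  (if does (∣ Z.- x ∣ N.≟ suc (toℕ j)) then sign (Z.- x) ◃ 1 else 0ℤ)
                                           ≡⟨ VP.lookup∘tabulate _ j ⟨
  lookup (unit (Z.- x)) j                  ∎
  where
  negate-coefficient : ∀ x j →
    (if does (∣ x ∣ N.≟ suc (toℕ j)) then Z.- (sign x ◃ 1) else 0ℤ) ≡
    (if does (∣ Z.- x ∣ N.≟ suc (toℕ j)) then sign (Z.- x) ◃ 1 else 0ℤ)
  negate-coefficient (+ zero) j = refl
  negate-coefficient (+ suc n) j = refl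
  negate-coefficient -[1+ n ] j = refl

unit≡·e : ∀ {m} x (a : Fin m) → suc (toℕ a) ≡ ∣ x ∣ → unit x ≡ (sign x ◃ 1) ·e a
unit≡·e x a a+1≡∣x∣ = vec-ext λ j → trans (VP.lookup∘tabulate _ j) (trans
  (cong (λ b → if b then sign x ◃ 1 else 0ℤ) (does-⇔ (mk⇔ to from) (∣ x ∣ N.≟ suc (toℕ j)) (j F.≟ a)))
  (sym (VP.lookup∘tabulate _ j)))
  where
  to : ∀ {j} → ∣ x ∣ ≡ suc (toℕ j) → j ≡ a
  to eq = FP.toℕ-injective (NP.suc-injective (trans (sym eq) (sym a+1≡∣x∣)))
  from : ∀ {j} → j ≡ a → ∣ x ∣ ≡ suc (toℕ j)
  from refl = sym a+1≡∣x∣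

rootPair : ∀ {m} → Fin m → Fin m → List (Vect m)
rootPair a b = (e a ⊖ e b) ∷ (e a ⊕ e b) ∷ []

rootPairsBelow : ∀ {m} → Fin m → List (Vect m)
rootPairsBelow {m} a = L.concatMap (rootPair a) (L.filter (F._<? a) (L.allFin m))

length-filter-Ψ : ∀ {m} {P : Vect m → Set} (P? : ∀ r → Dec (P r)) i → let p = opposite i in
  L.length (L.filter P? (Ψ i)) ≡
  [ does (P? (e p)) ] +
    ∑ λ j → if does (j F.<? p) then [ does (P? (e p ⊖ e j)) ] + [ does (P? (e p ⊕ e j)) ] else 0
length-filter-Ψ {m} P? i = begin
  L.length (L.filter P? (Ψ i))
    ≡⟨ length-filter P? (Ψ i) ⟩
  χ (e p) + sumᴸ (L.map χ (L.concatMap pair below-p))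
    ≡⟨ cong (_+_ (χ (e p))) (sumᴸ-map-concatMap χ pair below-p) ⟩
  χ (e p) + sumᴸ (L.map (sumᴸ ∘ L.map χ ∘ pair) below-p)
    ≡⟨ cong (_+_ (χ (e p))) (sumᴸ-map-filter (F._<? p) (sumᴸ ∘ L.map χ ∘ pair) (L.allFin m)) ⟩
  χ (e p) + sumᴸ (L.map (λ j → if does (j F.<? p) then sumᴸ (L.map χ (pair j)) else 0) (L.allFin m))
    ≡⟨ cong (_+_ (χ (e p))) (sumᴸ-map-allFin λ j → if does (j F.<? p) then sumᴸ (L.map χ (pair j)) else 0) ⟩
  χ (e p) + ∑ (λ j → if does (j F.<? p) then χ (e p ⊖ e j) + (χ (e p ⊕ e j) + 0) else 0)
    ≡⟨ cong (_+_ (χ (e p))) (sum-cong-≗ λ j →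
         cong (λ n → if does (j F.<? p) then χ (e p ⊖ e j) + n else 0) (NP.+-identityʳ (χ (e p ⊕ e j)))) ⟩
  χ (e p) + ∑ (λ j → if does (j F.<? p) then χ (e p ⊖ e j) + χ (e p ⊕ e j) else 0) ∎
  where
  p = opposite i
  χ : Vect m → ℕ
  χ r = [ does (P? r) ]
  pair = rootPair p
  below-p : List (Fin m)
  below-p = L.filter (F._<? p) (L.allFin m)

LeadsWith : ∀ {m} → ℤ → Vect m → Set
LeadsWith s x = ∃ λ a → lookup x a ≡ s × (∀ c → a F.< c → lookup x c ≡ 0ℤ)

leadsWith-unique : ∀ {m} {s t} {x : Vect m} → s ≢ 0ℤ → t ≢ 0ℤ → LeadsWith s x → LeadsWith t x → s ≡ t
leadsWith-unique {s = s} {t} s≢0 t≢0 (a , xa≡s , above-a) (b , xb≡t , above-b) with FP.<-cmp a b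
... | tri< a<b _ _ = contradiction (trans (sym xb≡t) (above-a b a<b)) t≢0
... | tri≈ _ refl _ = trans (sym xa≡s) xb≡t
... | tri> _ _ b<a = contradiction (trans (sym xa≡s) (above-b a b<a)) s≢0

leadsWith-neg : ∀ {m} {s} {x : Vect m} → LeadsWith s x → LeadsWith (Z.- s) (neg x)
leadsWith-neg {x = x} (a , xa≡s , above) =
  a , trans (lookup-neg x a) (cong Z.-_ xa≡s) , λ c a<c → trans (lookup-neg x c) (cong Z.-_ (above c a<c))

leadsWith-·e : ∀ {m} s (a : Fin m) → LeadsWith s (s ·e a)
leadsWith-·e s a = a , lookup-·e-same s a , λ c a<c → lookup-·e-other s (FP.<⇒≢ a<c)

leadsWith-·e⊕·e : ∀ {m} s t {a b : Fin m} → b F.< a → LeadsWith s (s ·e a ⊕ t ·e b)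
leadsWith-·e⊕·e s t {a} {b} b<a = a , at-a , above
  where
  at-a : lookup (s ·e a ⊕ t ·e b) a ≡ s
  at-a = trans (lookup-⊕ (s ·e a) (t ·e b) a)
    (trans (cong₂ Z._+_ (lookup-·e-same s a) (lookup-·e-other t (FP.<⇒≢ b<a))) (ZP.+-identityʳ s))
  above : ∀ c → a F.< c → lookup (s ·e a ⊕ t ·e b) c ≡ 0ℤ
  above c a<c = trans (lookup-⊕ (s ·e a) (t ·e b) c)
    (cong₂ Z._+_ (lookup-·e-other s (FP.<⇒≢ a<c)) (lookup-·e-other t (FP.<⇒≢ (FP.<-trans b<a a<c))))

e⊖e≡e⊕·e : ∀ {m} (a b : Fin m) → e a ⊖ e b ≡ e a ⊕ (-[1+ 0 ] ·e b)
e⊖e≡e⊕·e a b = trans (⊖≡⊕neg (e a) (e b)) (cong (e a ⊕_) (neg-·e (+ 1) b))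

Ψ⁺-leadsWith-1 : ∀ {m} {r : Vect m} → r ∈ Ψ⁺ m → LeadsWith (+ 1) r
Ψ⁺-leadsWith-1 {m} r∈ with ∈-++⁻ (L.map e (L.allFin m)) r∈
... | inj₁ r∈e with ∈-map⁻ e r∈e
...   | a , _ , refl = leadsWith-·e (+ 1) a
Ψ⁺-leadsWith-1 {m} r∈ | inj₂ r∈pairs
  with find (∈-concatMap⁻ rootPairsBelow {xs = L.allFin m} r∈pairs)
... | a , _ , r∈a with find (∈-concatMap⁻ (rootPair a) {xs = L.filter (F._<? a) (L.allFin m)} r∈a)
...   | b , b∈ , r∈ab with proj₂ (∈-filter⁻ (F._<? a) {xs = L.allFin m} b∈) | r∈ab
...     | b<a | here refl = subst (LeadsWith (+ 1)) (sym (e⊖e≡e⊕·e a b)) (leadsWith-·e⊕·e (+ 1) -[1+ 0 ] b<a)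
...     | b<a | there (here refl) = leadsWith-·e⊕·e (+ 1) (+ 1) b<a

Ψ⁻-leadsWith-−1 : ∀ {m} {r : Vect m} → r ∈ Ψ⁻ m → LeadsWith -[1+ 0 ] r
Ψ⁻-leadsWith-−1 r∈ with ∈-map⁻ neg r∈
... | r′ , r′∈ , refl = leadsWith-neg {x = r′} (Ψ⁺-leadsWith-1 r′∈)

e∈Ψ⁺ : ∀ {m} (a : Fin m) → e a ∈ Ψ⁺ m
e∈Ψ⁺ a = ∈-++⁺ˡ (∈-map⁺ e (∈-allFin a))

module _ {m} {a b : Fin m} (b<a : b F.< a) where

  private
    pair∈Ψ⁺ : ∀ {r} → r ∈ rootPair a b → r ∈ Ψ⁺ m
    pair∈Ψ⁺ r∈ = ∈-++⁺ʳ (L.map e (L.allFin m)) (∈-concatMap⁺ rootPairsBelow {xs = L.allFin m}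
      (lose (∈-allFin a) (∈-concatMap⁺ (rootPair a) {xs = L.filter (F._<? a) (L.allFin m)}
        (lose (∈-filter⁺ (F._<? a) (∈-allFin b) b<a) r∈))))

  e⊖e∈Ψ⁺ : e a ⊖ e b ∈ Ψ⁺ m
  e⊖e∈Ψ⁺ = pair∈Ψ⁺ (here refl)

  e⊕e∈Ψ⁺ : e a ⊕ e b ∈ Ψ⁺ m
  e⊕e∈Ψ⁺ = pair∈Ψ⁺ (there (here refl))

◃1≢0 : ∀ s → s ◃ 1 ≢ 0ℤ
◃1≢0 Sign.- ()
◃1≢0 Sign.+ ()

·e∈Ψ⁻⇔ : ∀ {m} s (a : Fin m) → ((s ◃ 1) ·e a ∈ Ψ⁻ m) ⇔ (s ≡ Sign.-)
·e∈Ψ⁻⇔ {m} s a = mk⇔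
  (λ r∈ → ZP.sign-cong (leadsWith-unique {x = (s ◃ 1) ·e a} (◃1≢0 s) (λ ())
                          (leadsWith-·e (s ◃ 1) a) (Ψ⁻-leadsWith-−1 r∈)))
  (λ { refl → subst (_∈ Ψ⁻ m) (neg-·e (+ 1) a) (∈-map⁺ neg (e∈Ψ⁺ a)) })

·e⊕·e∈Ψ⁻⇔ : ∀ {m} s t {a b : Fin m} → b F.< a → ((s ◃ 1) ·e a ⊕ (t ◃ 1) ·e b ∈ Ψ⁻ m) ⇔ (s ≡ Sign.-)
·e⊕·e∈Ψ⁻⇔ {m} s t {a} {b} b<a = mk⇔
  (λ r∈ → ZP.sign-cong (leadsWith-unique {x = (s ◃ 1) ·e a ⊕ (t ◃ 1) ·e b} (◃1≢0 s) (λ ())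
                          (leadsWith-·e⊕·e (s ◃ 1) (t ◃ 1) b<a) (Ψ⁻-leadsWith-−1 r∈)))
  (λ { refl → from t })
  where
  from : ∀ t → -[1+ 0 ] ·e a ⊕ (t ◃ 1) ·e b ∈ Ψ⁻ m
  from Sign.- = subst (_∈ Ψ⁻ m) (trans (neg-⊕ (e a) (e b)) (cong₂ _⊕_ (neg-·e (+ 1) a) (neg-·e (+ 1) b)))
                      (∈-map⁺ neg (e⊕e∈Ψ⁺ b<a))
  from Sign.+ = subst (_∈ Ψ⁻ m) (begin
      neg (e a ⊖ e b)              ≡⟨ cong neg (⊖≡⊕neg (e a) (e b)) ⟩
      neg (e a ⊕ neg (e b))        ≡⟨ neg-⊕ (e a) (neg (e b)) ⟩
      neg (e a) ⊕ neg (neg (e b))  ≡⟨ cong₂ _⊕_ (neg-·e (+ 1) a) (neg-involutive (e b)) ⟩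
      -[1+ 0 ] ·e a ⊕ e b          ∎)
    (∈-map⁺ neg (e⊖e∈Ψ⁺ b<a))

record AbsIndex (m : ℕ) (x : ℤ) : Set where
  constructor _,_
  field
    index : Fin m
    suc-index≡∣x∣ : suc (toℕ index) ≡ ∣ x ∣

absIndex-cong : ∀ {m x y} → ∣ x ∣ ≡ ∣ y ∣ → AbsIndex m x → AbsIndex m y
absIndex-cong ∣x∣≡∣y∣ (a , a+1≡∣x∣) = a , trans a+1≡∣x∣ ∣x∣≡∣y∣

absIndex-neg : ∀ {m x} → AbsIndex m x → AbsIndex m (Z.- x)
absIndex-neg {x = x} = absIndex-cong (sym (ZP.∣-i∣≡∣i∣ x))

absIndex-< : ∀ {m x} → AbsIndex m x → ∣ x ∣ N.< suc m
absIndex-< {m} (a , a+1≡∣x∣) = subst (N._< suc m) a+1≡∣x∣ (N.s≤s (FP.toℕ<n a))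

absIndex-inject₁ : ∀ {m x} → AbsIndex m x → AbsIndex (suc m) x
absIndex-inject₁ (a , a+1≡∣x∣) = F.inject₁ a , trans (cong suc (FP.toℕ-inject₁ a)) a+1≡∣x∣

absIndex-fromℕ : ∀ {m x} → ∣ x ∣ ≡ suc m → AbsIndex (suc m) x
absIndex-fromℕ {m} ∣x∣≡1+m = F.fromℕ m , trans (cong suc (FP.toℕ-fromℕ m)) (sym ∣x∣≡1+m)

sign≡-⇔<0 : ∀ x → (sign x ≡ Sign.-) ⇔ (x Z.< 0ℤ)
sign≡-⇔<0 (+ n) = mk⇔ (λ ()) (λ { (Z.+<+ ()) })
sign≡-⇔<0 -[1+ n ] = mk⇔ (λ _ → Z.-<+) (λ _ → refl)

unit∈Ψ⁻⇔ : ∀ {m x} → AbsIndex m x → (unit x ∈ Ψ⁻ m) ⇔ (x Z.< 0ℤ)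
unit∈Ψ⁻⇔ {m} {x} (a , a+1≡∣x∣) =
  sign≡-⇔<0 x ⇔-∘ subst (λ z → (z ∈ Ψ⁻ m) ⇔ _) (sym (unit≡·e x a a+1≡∣x∣)) (·e∈Ψ⁻⇔ (sign x) a)

dominant : ℤ → ℤ → ℤ
dominant x y = if does (∣ y ∣ N.<? ∣ x ∣) then x else y

dominant-< : ∀ {x y} → ∣ y ∣ N.< ∣ x ∣ → dominant x y ≡ x
dominant-< {x} {y} y<x rewrite dec-true (∣ y ∣ N.<? ∣ x ∣) y<x = refl

dominant-≮ : ∀ {x y} → ¬ (∣ y ∣ N.< ∣ x ∣) → dominant x y ≡ y
dominant-≮ {x} {y} y≮x rewrite dec-false (∣ y ∣ N.<? ∣ x ∣) y≮x = refl

unit⊕unit∈Ψ⁻⇔-< : ∀ {m x y} → AbsIndex m x → AbsIndex m y → ∣ y ∣ N.< ∣ x ∣ →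
  (unit x ⊕ unit y ∈ Ψ⁻ m) ⇔ (x Z.< 0ℤ)
unit⊕unit∈Ψ⁻⇔-< {m} {x} {y} (a , a+1≡∣x∣) (b , b+1≡∣y∣) y<x = sign≡-⇔<0 x ⇔-∘
  subst (λ z → (z ∈ Ψ⁻ m) ⇔ _) (sym (cong₂ _⊕_ (unit≡·e x a a+1≡∣x∣) (unit≡·e y b b+1≡∣y∣)))
    (·e⊕·e∈Ψ⁻⇔ (sign x) (sign y) (NP.≤-pred (subst₂ N._<_ (sym b+1≡∣y∣) (sym a+1≡∣x∣) y<x)))

unit⊕unit∈Ψ⁻⇔ : ∀ {m x y} → AbsIndex m x → AbsIndex m y → ∣ x ∣ ≢ ∣ y ∣ →
  (unit x ⊕ unit y ∈ Ψ⁻ m) ⇔ (dominant x y Z.< 0ℤ)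
unit⊕unit∈Ψ⁻⇔ {m} {x} {y} ix iy ∣x∣≢∣y∣ with ∣ y ∣ N.<? ∣ x ∣
... | yes y<x = subst (λ z → (unit x ⊕ unit y ∈ Ψ⁻ m) ⇔ (z Z.< 0ℤ)) (sym (dominant-< {x} y<x))
  (unit⊕unit∈Ψ⁻⇔-< {x = x} {y} ix iy y<x)
... | no y≮x = subst₂ (λ u z → (u ∈ Ψ⁻ m) ⇔ (z Z.< 0ℤ)) (⊕-comm (unit y) (unit x)) (sym (dominant-≮ {x} y≮x))
  (unit⊕unit∈Ψ⁻⇔-< {x = y} {x} iy ix (NP.≤∧≢⇒< (NP.≮⇒≥ y≮x) ∣x∣≢∣y∣))

record SignedInjection {m} (v : Vec ℤ m) : Set where
  constructor _,_
  field
    absIndex : ∀ p → AbsIndex m (lookup v p)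
    abs-injective : ∀ p q → ∣ lookup v p ∣ ≡ ∣ lookup v q ∣ → p ≡ q

isSignedPerm⇒signedInjection : ∀ {m} {v : Vec ℤ m} → IsSignedPerm v → SignedInjection v
isSignedPerm⇒signedInjection {v = v} (β , ε , v≡ε◃β) = absIndex , abs-injective
  where
  ∣v∣≡ : ∀ p → ∣ lookup v p ∣ ≡ suc (toℕ (β ⟨$⟩ʳ p))
  ∣v∣≡ p = trans (cong ∣_∣ (v≡ε◃β p)) (ZP.abs-◃ (ε p) _)
  absIndex : ∀ p → AbsIndex _ (lookup v p)
  absIndex p = β ⟨$⟩ʳ p , sym (∣v∣≡ p)
  abs-injective : ∀ p q → ∣ lookup v p ∣ ≡ ∣ lookup v q ∣ → p ≡ q
  abs-injective p q ∣vp∣≡∣vq∣ = trans (sym (inverseˡ β)) (trans (cong (β ⟨$⟩ˡ_) βp≡βq) (inverseˡ β))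
    where βp≡βq = FP.toℕ-injective (NP.suc-injective (trans (sym (∣v∣≡ p)) (trans ∣vp∣≡∣vq∣ (∣v∣≡ q))))

≡⊎≡punchIn : ∀ {m} (i j : Fin (suc m)) → j ≡ i ⊎ ∃ λ j′ → j ≡ F.punchIn i j′
≡⊎≡punchIn i j with j F.≟ i
... | yes j≡i = inj₁ j≡i
... | no j≢i = inj₂ (F.punchOut (j≢i ∘ sym) , sym (FP.punchIn-punchOut (j≢i ∘ sym)))

insertAt-signedInjection : ∀ {m} (xs : Vec ℤ m) i z → ∣ z ∣ ≡ suc m →
  SignedInjection xs → SignedInjection (insertAt xs i z)
insertAt-signedInjection {m} xs i z ∣z∣≡1+m xs-injection = absIndex′ , abs-injective′
  where
  open SignedInjection xs-injection
  ys = insertAt xs i z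
  ∣ys-i∣ : ∣ lookup ys i ∣ ≡ ∣ z ∣
  ∣ys-i∣ = cong ∣_∣ (VP.insertAt-lookup xs i z)
  ∣ys-punchIn∣ : ∀ p → ∣ lookup ys (F.punchIn i p) ∣ ≡ ∣ lookup xs p ∣
  ∣ys-punchIn∣ p = cong ∣_∣ (VP.insertAt-punchIn xs i z p)
  ∣z∣≢ : ∀ p → ∣ z ∣ ≢ ∣ lookup xs p ∣
  ∣z∣≢ p ∣z∣≡ = NP.<⇒≢ (absIndex-< (absIndex p)) (trans (sym ∣z∣≡) ∣z∣≡1+m)

  absIndex′ : ∀ p → AbsIndex (suc m) (lookup ys p)
  absIndex′ p with ≡⊎≡punchIn i p
  ... | inj₁ refl = absIndex-cong (sym ∣ys-i∣) (absIndex-fromℕ {x = z} ∣z∣≡1+m)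
  ... | inj₂ (p′ , refl) = absIndex-cong (sym (∣ys-punchIn∣ p′)) (absIndex-inject₁ (absIndex p′))

  abs-injective′ : ∀ p q → ∣ lookup ys p ∣ ≡ ∣ lookup ys q ∣ → p ≡ q
  abs-injective′ p q eq with ≡⊎≡punchIn i p | ≡⊎≡punchIn i q
  ... | inj₁ refl | inj₁ refl = refl
  ... | inj₁ refl | inj₂ (q′ , refl) = ⊥-elim (∣z∣≢ q′ (trans (sym ∣ys-i∣) (trans eq (∣ys-punchIn∣ q′))))
  ... | inj₂ (p′ , refl) | inj₁ refl = ⊥-elim (∣z∣≢ p′ (trans (sym ∣ys-i∣) (trans (sym eq) (∣ys-punchIn∣ p′))))
  ... | inj₂ (p′ , refl) | inj₂ (q′ , refl) =
    cong (F.punchIn i) (abs-injective p′ q′ (trans (sym (∣ys-punchIn∣ p′)) (trans eq (∣ys-punchIn∣ q′))))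

χ⁻ : ℤ → ℕ
χ⁻ x = [ does (x Z.<? 0ℤ) ]

pairInversions : ℤ → ℤ → ℕ
pairInversions x y = χ⁻ (dominant x (Z.- y)) + χ⁻ (dominant x y)

inversionsAt : ∀ {m} → Vec ℤ m → Fin m → ℕ
inversionsAt v p =
  χ⁻ (lookup v p) + ∑ λ j → if does (j F.<? p) then pairInversions (lookup v p) (lookup v j) else 0

module _ {m : ℕ} where
  -- the decision procedure that invᵢ filters with
  open DecMem (VP.≡-dec {n = m} Z._≟_) using (_∈?_)

  negRoot? : (v r : Vect m) → Dec (act v r ∈ Ψ⁻ m)
  negRoot? v r = act v r ∈? Ψ⁻ m

module _ {m} (v : Vec ℤ m) (v-injection : SignedInjection v) where
  open SignedInjection v-injection

  private
    χ-negRoot : ∀ r {u x} → act v r ≡ u → (u ∈ Ψ⁻ m) ⇔ (x Z.< 0ℤ) → [ does (negRoot? v r) ] ≡ χ⁻ x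
    χ-negRoot r {x = x} refl u∈⇔ = cong [_] (does-⇔ u∈⇔ (negRoot? v r) (x Z.<? 0ℤ))

    χ-e : ∀ p → [ does (negRoot? v (e p)) ] ≡ χ⁻ (lookup v p)
    χ-e p = χ-negRoot (e p) (act-e v p) (unit∈Ψ⁻⇔ (absIndex p))

    χ-e⊕e : ∀ {p j} → p ≢ j → [ does (negRoot? v (e p ⊕ e j)) ] ≡ χ⁻ (dominant (lookup v p) (lookup v j))
    χ-e⊕e {p} {j} p≢j =
      χ-negRoot (e p ⊕ e j) (trans (act-⊕ v (e p) (e j)) (cong₂ _⊕_ (act-e v p) (act-e v j)))
      (unit⊕unit∈Ψ⁻⇔ (absIndex p) (absIndex j) (p≢j ∘ abs-injective p j))

    χ-e⊖e : ∀ {p j} → p ≢ j → [ does (negRoot? v (e p ⊖ e j)) ] ≡ χ⁻ (dominant (lookup v p) (Z.- lookup v j))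
    χ-e⊖e {p} {j} p≢j = χ-negRoot (e p ⊖ e j) act-e⊖e
      (unit⊕unit∈Ψ⁻⇔ (absIndex p) (absIndex-neg (absIndex j))
        (p≢j ∘ abs-injective p j ∘ λ eq → trans eq (ZP.∣-i∣≡∣i∣ (lookup v j))))
      where
      act-e⊖e : act v (e p ⊖ e j) ≡ unit (lookup v p) ⊕ unit (Z.- lookup v j)
      act-e⊖e = begin
        act v (e p ⊖ e j)                          ≡⟨ act-⊖ v (e p) (e j) ⟩
        act v (e p) ⊕ neg (act v (e j))            ≡⟨ cong₂ _⊕_ (act-e v p) (cong neg (act-e v j)) ⟩
        unit (lookup v p) ⊕ neg (unit (lookup v j)) ≡⟨ cong (unit (lookup v p) ⊕_) (neg-unit (lookup v j)) ⟩
        unit (lookup v p) ⊕ unit (Z.- lookup v j)   ∎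

  invᵢ≡inversionsAt : ∀ i → invᵢ v i ≡ inversionsAt v (opposite i)
  invᵢ≡inversionsAt i = trans (length-filter-Ψ (negRoot? v) i)
    (cong₂ _+_ (χ-e p) (sum-cong-≗ λ j → pair-count j (j F.<? p)))
    where
    p = opposite i
    pair-count : ∀ j (j<?p : Dec (j F.< p)) →
      (if does j<?p then [ does (negRoot? v (e p ⊖ e j)) ] + [ does (negRoot? v (e p ⊕ e j)) ] else 0) ≡
      (if does j<?p then pairInversions (lookup v p) (lookup v j) else 0)
    pair-count j (yes j<p) = cong₂ _+_ (χ-e⊖e (FP.<⇒≢ j<p ∘ sym)) (χ-e⊕e (FP.<⇒≢ j<p ∘ sym))
    pair-count j (no _) = refl

inversionsRec : ∀ {m} → Vec ℤ m → ℕ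
inversionsRec V.[] = 0
inversionsRec (x V.∷ xs) = χ⁻ x + ∑ (λ p → pairInversions (lookup xs p) x) + inversionsRec xs

inversionsAt-head : ∀ {m} x (xs : Vec ℤ m) → inversionsAt (x V.∷ xs) F.zero ≡ χ⁻ x
inversionsAt-head {m} x xs = trans (cong (_+_ (χ⁻ x)) (sum-replicate-zero (suc m))) (NP.+-identityʳ (χ⁻ x))

inversionsAt-tail : ∀ {m} x (xs : Vec ℤ m) p →
  inversionsAt (x V.∷ xs) (F.suc p) ≡ pairInversions (lookup xs p) x + inversionsAt xs p
inversionsAt-tail x xs p = x∙yz≈y∙xz (χ⁻ (lookup xs p)) (pairInversions (lookup xs p) x) _

∑-inversionsAt : ∀ {m} (v : Vec ℤ m) → ∑ (inversionsAt v) ≡ inversionsRec v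
∑-inversionsAt V.[] = refl
∑-inversionsAt (x V.∷ xs) = begin
  inversionsAt (x V.∷ xs) F.zero + ∑ (inversionsAt (x V.∷ xs) ∘ F.suc)
    ≡⟨ cong₂ _+_ (inversionsAt-head x xs)
                 (trans (sum-cong-≗ (inversionsAt-tail x xs)) (∑-distrib-+ column (inversionsAt xs))) ⟩
  χ⁻ x + (∑ column + ∑ (inversionsAt xs))
    ≡⟨ NP.+-assoc (χ⁻ x) (∑ column) _ ⟨
  χ⁻ x + ∑ column + ∑ (inversionsAt xs)
    ≡⟨ cong (_+_ (χ⁻ x + ∑ column)) (∑-inversionsAt xs) ⟩
  inversionsRec (x V.∷ xs) ∎
  where
  column = λ p → pairInversions (lookup xs p) x

inv≡inversionsRec : ∀ {m} (v : Vec ℤ m) → SignedInjection v → inv v ≡ inversionsRec v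
inv≡inversionsRec v sv = begin
  inv v                         ≡⟨ sumᴸ-map-allFin (invᵢ v) ⟩
  ∑ (invᵢ v)                    ≡⟨ sum-cong-≗ (invᵢ≡inversionsAt v sv) ⟩
  ∑ (inversionsAt v ∘ opposite) ≡⟨ ∑-reverse (inversionsAt v) ⟩
  ∑ (inversionsAt v)            ≡⟨ ∑-inversionsAt v ⟩
  inversionsRec v               ∎

∑-insertAt : ∀ {m} (xs : Vec ℤ m) i y (f : ℤ → ℕ) →
  ∑ (f ∘ lookup (insertAt xs i y)) ≡ f y + ∑ (f ∘ lookup xs)
∑-insertAt xs F.zero y f = refl
∑-insertAt (x V.∷ xs) (F.suc i) y f = trans (cong (_+_ (f x)) (∑-insertAt xs i y f)) (x∙yz≈y∙xz (f x) (f y) _)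

χ⁻-neg+χ⁻ : ∀ z → 0 N.< ∣ z ∣ → χ⁻ (Z.- z) + χ⁻ z ≡ 1
χ⁻-neg+χ⁻ (+ suc n) _ = refl
χ⁻-neg+χ⁻ -[1+ n ] _ = refl

pairInversions-below : ∀ y z → ∣ y ∣ N.< ∣ z ∣ → pairInversions y z ≡ 1
pairInversions-below y z y<z = begin
  χ⁻ (dominant y (Z.- z)) + χ⁻ (dominant y z)
    ≡⟨ cong₂ _+_ (cong χ⁻ (dominant-≮ {y} (NP.<⇒≯ (subst (∣ y ∣ N.<_) (sym (ZP.∣-i∣≡∣i∣ z)) y<z))))
                 (cong χ⁻ (dominant-≮ {y} (NP.<⇒≯ y<z))) ⟩
  χ⁻ (Z.- z) + χ⁻ z
    ≡⟨ χ⁻-neg+χ⁻ z (NP.≤-<-trans N.z≤n y<z) ⟩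
  1 ∎

pairInversions-above : ∀ x z → ∣ x ∣ N.< ∣ z ∣ → pairInversions z x ≡ χ⁻ z + χ⁻ z
pairInversions-above x z x<z =
  cong₂ _+_ (cong χ⁻ (dominant-< {z} (subst (N._< ∣ z ∣) (sym (ZP.∣-i∣≡∣i∣ x)) x<z))) (cong χ⁻ (dominant-< {z} x<z))

inversionsRec-insertAt : ∀ {m} (xs : Vec ℤ m) i z → (∀ p → ∣ lookup xs p ∣ N.< ∣ z ∣) →
  inversionsRec (insertAt xs i z) ≡ χ⁻ z + toℕ i * (χ⁻ z + χ⁻ z) + (m ∸ toℕ i) + inversionsRec xs
inversionsRec-insertAt {m} xs F.zero z below = cong (_+ inversionsRec xs) (cong₂ _+_
  (sym (NP.+-identityʳ (χ⁻ z)))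
  (trans (sum-cong-≗ λ p → pairInversions-below (lookup xs p) z (below p)) (∑-const-1 m)))
inversionsRec-insertAt {suc m} (x V.∷ xs) (F.suc i) z below = begin
  χ⁻ x + ∑ (λ p → pairInversions (lookup (insertAt xs i z) p) x) + inversionsRec (insertAt xs i z)
    ≡⟨ cong₂ (λ s r → χ⁻ x + s + r)
         (trans (∑-insertAt xs i z (λ y → pairInversions y x))
                (cong (_+ column) (pairInversions-above x z (below F.zero))))
         (inversionsRec-insertAt xs i z (below ∘ F.suc)) ⟩
  χ⁻ x + (χ⁻ z + χ⁻ z + column) + (χ⁻ z + toℕ i * (χ⁻ z + χ⁻ z) + (m ∸ toℕ i) + inversionsRec xs)
    ≡⟨ rearrange (χ⁻ x) column (χ⁻ z) (toℕ i) (m ∸ toℕ i) (inversionsRec xs) ⟩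
  χ⁻ z + suc (toℕ i) * (χ⁻ z + χ⁻ z) + (suc m ∸ suc (toℕ i)) + (χ⁻ x + column + inversionsRec xs) ∎
  where
  column = ∑ λ p → pairInversions (lookup xs p) x
  rearrange : ∀ a b c t d r →
    a + (c + c + b) + (c + t * (c + c) + d + r) ≡ c + suc t * (c + c) + d + (a + b + r)
  rearrange = solve-∀

inv-insertAt : ∀ {m} (xs : Vec ℤ m) i z → SignedInjection xs → ∣ z ∣ ≡ suc m →
  inv (insertAt xs i z) ≡ χ⁻ z + toℕ i * (χ⁻ z + χ⁻ z) + (m ∸ toℕ i) + inv xs
inv-insertAt {m} xs i z xs-injection ∣z∣≡1+m = begin
  inv (insertAt xs i z)
    ≡⟨ inv≡inversionsRec (insertAt xs i z) (insertAt-signedInjection xs i z ∣z∣≡1+m xs-injection) ⟩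
  inversionsRec (insertAt xs i z)
    ≡⟨ inversionsRec-insertAt xs i z below ⟩
  extra + inversionsRec xs
    ≡⟨ cong (_+_ extra) (inv≡inversionsRec xs xs-injection) ⟨
  extra + inv xs ∎
  where
  extra = χ⁻ z + toℕ i * (χ⁻ z + χ⁻ z) + (m ∸ toℕ i)
  below : ∀ p → ∣ lookup xs p ∣ N.< ∣ z ∣
  below p = subst (∣ lookup xs p ∣ N.<_) (sym ∣z∣≡1+m) (absIndex-< (SignedInjection.absIndex xs-injection p))

mainTheorem5 : (k : ℕ) → 1 ≤ k → (π : Vec ℤ k) → IsSignedPerm π → (i : Fin (suc k))
    → (inv (insertAt π i (+ suc k)) ≡ (suc k ∸ toℕ i ∸ 1) + inv π)
      × (inv (insertAt π i -[1+ k ]) ≡ suc k + toℕ i + inv π)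
mainTheorem5 k _ π π-signed i =
  trans (inv-insertAt π i (+ suc k) π-injection refl) (cong (_+ inv π) (positive-count (toℕ i))) ,
  trans (inv-insertAt π i -[1+ k ] π-injection refl) (cong (_+ inv π) (negative-count (toℕ i) i≤k))
  where
  π-injection = isSignedPerm⇒signedInjection π-signed
  i≤k = NP.≤-pred (FP.toℕ<n i)

  positive-count : ∀ t → t * 0 + (k ∸ t) ≡ suc k ∸ t ∸ 1
  positive-count t = trans (cong (_+ (k ∸ t)) (NP.*-zeroʳ t))
    (sym (trans (NP.∸-+-assoc (suc k) t 1) (cong (suc k ∸_) (NP.+-comm t 1))))

  negative-count : ∀ t → t ≤ k → suc (t * 2 + (k ∸ t)) ≡ suc k + t
  negative-count t t≤k = cong suc (begin
    t * 2 + (k ∸ t)     ≡⟨ double t (k ∸ t) ⟩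
    t + (t + (k ∸ t))   ≡⟨ cong (_+_ t) (NP.m+[n∸m]≡n t≤k) ⟩
    t + k               ≡⟨ NP.+-comm t k ⟩
    k + t               ∎)
    where
    double : ∀ t d → t * 2 + d ≡ t + (t + d)
    double = solve-∀
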